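{- For every positive integer $n$, $r_3(P_4, n) \leq \left\lceil\left(\frac{2}{2 - \sqrt{2}}\right)^n\right\rceil$.
   Context: $r_3(P_4,n)$ is the minimum $N$ such that every red-blue coloring of the 3-element subsets of $[N]=\{1,\dots,N\}$ contains either four vertices $v_1<v_2<v_3<v_4$ with $\{v_1,v_2,v_3\}$ and $\{v_2,v_3,v_4\}$ both red, or a set of $n$ vertices all of whose 3-subsets are blue. -}

module Defs where

open import Data.Nat using (ℕ; zero; suc; _+_; _*_; _∸_; _≤_)
open import Data.Fin using (Fin) renaming (_<_ to _<ᶠ_)
open import Data.Bool using (Bool; true; false)
open import Data.Product using (_×_; Σ; ∃; ∃-syntax)
open import Data.Sum using (_⊎_)
open import Relation.Binary.PropositionalEquality using (_≡_)
open import Relation.Nullary using (¬_)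

-- Real numbers of the form a + b·√2 with a b : ℕ, and the base
-- 2/(2-√2) = 2 + √2.  We have (2+√2)^n = powA n + powB n · √2.

powA powB : ℕ → ℕ
powA zero    = 1
powA (suc n) = 2 * powA n + 2 * powB n
powB zero    = 0
powB (suc n) = powA n + 2 * powB n

_+√2·_≤_ : ℕ → ℕ → ℕ → Set
a +√2· b ≤ c = (a ≤ c) × (2 * (b * b) ≤ (c ∸ a) * (c ∸ a))

PowLe : ℕ → ℕ → Set
PowLe n c = powA n +√2· powB n ≤ c

-- c is the ceiling of (2/(2-√2))^n :  c - 1 < (2/(2-√2))^n ≤ c
-- (for c = 0 the first condition reads ¬ (x ≤ 0), which is correct
--  since x > 0 anyway).
IsCeilPow : ℕ → ℕ → Set
IsCeilPow n c = PowLe n c × ¬ PowLe n (c ∸ 1)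

-- Red/blue colourings of the 3-element subsets of [N] = Fin N.
-- A colouring is a function on triples; only its values on strictly
-- increasing triples i < j < k are ever consulted.  red = true.

Colouring : ℕ → Set
Colouring N = Fin N → Fin N → Fin N → Bool

red blue : Bool
red  = true
blue = false

HasRedP4 : ∀ {N} → Colouring N → Set
HasRedP4 {N} χ = ∃[ v₁ ] ∃[ v₂ ] ∃[ v₃ ] ∃[ v₄ ]
  ((v₁ <ᶠ v₂) × (v₂ <ᶠ v₃) × (v₃ <ᶠ v₄)
   × (χ v₁ v₂ v₃ ≡ red) × (χ v₂ v₃ v₄ ≡ red))

HasBlueClique : ∀ {N} → Colouring N → ℕ → Set
HasBlueClique {N} χ n = Σ (Fin n → Fin N) λ f →
  (∀ i j → i <ᶠ j → f i <ᶠ f j) ×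
  (∀ i j k → i <ᶠ j → j <ᶠ k → χ (f i) (f j) (f k) ≡ blue)

Arrows : ℕ → ℕ → Set
Arrows N n = ∀ (χ : Colouring N) → HasRedP4 χ ⊎ HasBlueClique χ n

-- Call a pair b < c left-blue if every triple a b c with a < b is blue.  Without a
-- red P4, a red triple b c d forces b c to be left-blue, so every triple x y z with
-- x y not left-blue, or with y z left-blue, is blue.  Hence an increasing sequence
-- whose prefix is pairwise not left-blue and whose suffix is pairwise left-blue is a
-- blue clique.  The ordered Ramsey bound 2^(s+t) for chains of length s+1 / t+1 finds
-- such a sequence of length n = s+t+2, taking the prefix from the first half of [N]
-- and the suffix from the second.  For balanced s, t this needs N = 2^⌊(3n-1)/2⌋
-- points, and N ≤ powA n ≤ powA n + powB n·√2 = (2+√2)^n ≤ c.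
module Submission where

open import Defs
open import Data.Nat using (ℕ; _≤_; _>_; zero; suc; _+_; _*_; _∸_; _⊓_; _^_; z≤n; s≤s; _≤?_)
open import Data.Nat.Properties
  using ( ≤-refl; ≤-trans; ≤-reflexive; +-suc; +-comm; +-identityʳ; +-cancelˡ-≤
        ; +-monoˡ-≤; +-monoʳ-≤; *-monoʳ-≤; ^-monoʳ-≤; m^n>0; ≰⇒>
        ; m≤n⇒m⊓n≡m; m≤m+n; m+n∸m≡n; module ≤-Reasoning)
open import Data.Nat.Tactic.RingSolver using (solve-∀)
open import Data.Fin using (Fin) renaming (_<_ to _<ᶠ_; zero to fzero; suc to fsuc)
open import Data.Fin.Properties using (all?; any?) renaming (_<?_ to _<ᶠ?_)
open import Data.Bool using (true; false)
open import Data.Bool.Properties using (_≟_)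
open import Data.List using (List; []; _∷_; _++_; length; filter; lookup; take; drop; allFin)
open import Data.List.Properties using (length-++; length-take; length-drop; length-tabulate; take++drop≡id; ++-identityʳ)
open import Data.List.Relation.Unary.All as All using (All; []; _∷_)
open import Data.List.Relation.Unary.All.Properties using (all-filter)
open import Data.List.Relation.Unary.AllPairs as AllPairs using (AllPairs; []; _∷_)
open import Data.List.Relation.Unary.AllPairs.Properties using (tabulate⁺-<)
open import Data.List.Relation.Binary.Sublist.Propositional using (_⊆_; []; _∷_; _∷ʳ_; ⊆-trans)
open import Data.List.Relation.Binary.Sublist.Propositional.Properties
  using (All-resp-⊆; filter-⊆; []⊆-universal; ++⁺; ++⁺ˡ; ++⁺ʳ)
open import Data.Product using (_×_; ∃-syntax; _,_)
open import Data.Sum using (_⊎_; inj₁; inj₂) renaming (map to ⊎-map)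
open import Data.Empty using (⊥-elim)
open import Function using (id)
open import Relation.Nullary using (¬_; Dec; yes; no; ¬?)
open import Relation.Nullary.Decidable using (_×-dec_; _→-dec_)
open import Relation.Binary.PropositionalEquality using (_≡_; refl; sym; trans; cong; cong₂; subst; module ≡-Reasoning)

pigeonhole₂ : ∀ {m a b} → 2 * m ≤ suc (a + b) → ¬ m ≤ a → m ≤ b
pigeonhole₂ {m} {a} {b} 2m≤ m≰a = +-cancelˡ-≤ m m b (begin
  m + m       ≡⟨ cong (m +_) (sym (+-identityʳ m)) ⟩
  2 * m       ≤⟨ 2m≤ ⟩
  suc a + b   ≤⟨ +-monoˡ-≤ b (≰⇒> m≰a) ⟩
  m + b       ∎)
  where open ≤-Reasoning

data AllTriples {A : Set} (T : A → A → A → Set) : List A → Set where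
  []  : AllTriples T []
  _∷_ : ∀ {x xs} → AllPairs (T x) xs → AllTriples T xs → AllTriples T (x ∷ xs)

module _ {A : Set} where

  AllPairs-resp-⊆ : ∀ {R : A → A → Set} {xs ys} → xs ⊆ ys → AllPairs R ys → AllPairs R xs
  AllPairs-resp-⊆ []         []           = []
  AllPairs-resp-⊆ (_ ∷ʳ τ)   (_ ∷ rys)    = AllPairs-resp-⊆ τ rys
  AllPairs-resp-⊆ (refl ∷ τ) (rx ∷ rys)   = All-resp-⊆ τ rx ∷ AllPairs-resp-⊆ τ rys

  All-lookup : ∀ {P : A → Set} {xs} → All P xs → ∀ i → P (lookup xs i)
  All-lookup (px ∷ _)   fzero    = px
  All-lookup (_  ∷ pxs) (fsuc i) = All-lookup pxs i

  AllPairs-lookup : ∀ {R : A → A → Set} {xs} → AllPairs R xs →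
                    ∀ i j → i <ᶠ j → R (lookup xs i) (lookup xs j)
  AllPairs-lookup (rx ∷ _)   fzero    (fsuc j) _         = All-lookup rx j
  AllPairs-lookup (_  ∷ rxs) (fsuc i) (fsuc j) (s≤s i<j) = AllPairs-lookup rxs i j i<j

  AllTriples-lookup : ∀ {T : A → A → A → Set} {xs} → AllTriples T xs →
                      ∀ i j k → i <ᶠ j → j <ᶠ k → T (lookup xs i) (lookup xs j) (lookup xs k)
  AllTriples-lookup (tx ∷ _)   fzero    (fsuc j) (fsuc k) _         (s≤s j<k) =
    AllPairs-lookup tx j k j<k
  AllTriples-lookup (_  ∷ txs) (fsuc i) (fsuc j) (fsuc k) (s≤s i<j) (s≤s j<k) =
    AllTriples-lookup txs i j k i<j j<k

  module _ {P Q : A → A → Set} where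

    ++-allTriples : ∀ {as bs} → AllPairs P as → AllPairs Q bs →
                    AllTriples (λ x y z → P x y ⊎ Q y z) (as ++ bs)
    ++-allTriples []         qbs = suffix qbs
      where
      suffix : ∀ {bs} → AllPairs Q bs → AllTriples (λ x y z → P x y ⊎ Q y z) bs
      suffix []         = []
      suffix (_ ∷ qbs) = AllPairs.map inj₂ qbs ∷ suffix qbs
    ++-allTriples {x ∷ _} (px ∷ pas) qbs = after px qbs ∷ ++-allTriples pas qbs
      where
      after : ∀ {as bs} → All (P x) as → AllPairs Q bs → AllPairs (λ y z → P x y ⊎ Q y z) (as ++ bs)
      after []         qbs = AllPairs.map inj₂ qbs
      after {_ ∷ as} {bs} (pxy ∷ pxs) qbs = All.universal (λ _ → inj₁ pxy) (as ++ bs) ∷ after pxs qbs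

  length-filter-∁ : ∀ {P : A → Set} (P? : ∀ x → Dec (P x)) xs →
                    length (filter (λ x → ¬? (P? x)) xs) + length (filter P? xs) ≡ length xs
  length-filter-∁ P? []       = refl
  length-filter-∁ P? (x ∷ xs) with P? x
  ... | yes _ = trans (+-suc _ _) (cong suc (length-filter-∁ P? xs))
  ... | no  _ = cong suc (length-filter-∁ P? xs)

  Chain : (A → A → Set) → ℕ → List A → Set
  Chain R k xs = ∃[ ys ] (ys ⊆ xs × length ys ≡ k × AllPairs R ys)

  singleton-chain : ∀ {R : A → A → Set} x xs → Chain R 1 (x ∷ xs)
  singleton-chain x xs = x ∷ [] , refl ∷ []⊆-universal xs , refl , [] ∷ []

  Chain-mono : ∀ {R : A → A → Set} {k xs ys} → xs ⊆ ys → Chain R k xs → Chain R k ys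
  Chain-mono xs⊆ (zs , zs⊆ , len , rzs) = zs , ⊆-trans zs⊆ xs⊆ , len , rzs

  cons-chain : ∀ {R : A → A → Set} (R? : ∀ x y → Dec (R x y)) {k} x xs →
               Chain R k (filter (R? x) xs) → Chain R (suc k) (x ∷ xs)
  cons-chain R? x xs (ys , ys⊆ , refl , rys) =
    x ∷ ys , refl ∷ ⊆-trans ys⊆ (filter-⊆ (R? x) xs) , refl ,
    All-resp-⊆ ys⊆ (all-filter (R? x) xs) ∷ rys

  module _ {R : A → A → Set} (R? : ∀ x y → Dec (R x y)) where

    NonR : A → A → Set
    NonR x y = ¬ R x y

    ordered-ramsey : ∀ s t xs → 2 ^ (s + t) ≤ length xs → Chain NonR (suc s) xs ⊎ Chain R (suc t) xs
    ordered-ramsey s t [] big with () ← ≤-trans (m^n>0 2 (s + t)) big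
    ordered-ramsey zero    t       (x ∷ xs) _ = inj₁ (singleton-chain x xs)
    ordered-ramsey (suc s) zero    (x ∷ xs) _ = inj₂ (singleton-chain x xs)
    ordered-ramsey (suc s) (suc t) (x ∷ xs) big
      with 2 ^ (s + suc t) ≤? length (filter (λ y → ¬? (R? x y)) xs)
    ... | yes bigNonR = ⊎-map (cons-chain (λ x y → ¬? (R? x y)) x xs)
                                     (Chain-mono (x ∷ʳ filter-⊆ _ xs))
                          (ordered-ramsey s (suc t) _ bigNonR)
    ... | no  smallNonR = ⊎-map (Chain-mono (x ∷ʳ filter-⊆ _ xs)) (cons-chain R? x xs)
                            (ordered-ramsey (suc s) t _ bigR)
      where
      bigR : 2 ^ (suc s + t) ≤ length (filter (R? x) xs)
      bigR = subst (λ e → 2 ^ e ≤ length (filter (R? x) xs)) (+-suc s t)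
        (pigeonhole₂ (subst (λ l → _ ≤ suc l) (sym (length-filter-∁ (R? x) xs)) big) smallNonR)

    SplitChain : ℕ → List A → Set
    SplitChain k xs = ∃[ as ] ∃[ bs ]
      (as ++ bs ⊆ xs × length (as ++ bs) ≡ k × AllPairs NonR as × AllPairs R bs)

    split-chain : ∀ s t xs ys → 2 ^ (s + suc (s + t)) ≤ length xs → 2 ^ (suc (s + t) + t) ≤ length ys →
                  SplitChain (2 + s + t) (xs ++ ys)
    split-chain s t xs ys bigX bigY
      with ordered-ramsey s (suc (s + t)) xs bigX | ordered-ramsey (suc (s + t)) t ys bigY
    ... | inj₂ (bs , bs⊆ , len , rbs) | _ = [] , bs , ++⁺ʳ ys bs⊆ , len , [] , rbs
    ... | inj₁ (as , as⊆ , lenA , ras) | inj₂ (bs , bs⊆ , lenB , rbs) =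
      as , bs , ++⁺ as⊆ bs⊆ ,
      trans (length-++ as) (trans (cong₂ _+_ lenA lenB) (cong suc (+-suc s t))) , ras , rbs
    ... | inj₁ _ | inj₁ (as , as⊆ , len , ras) =
      as , [] , subst (_⊆ xs ++ ys) (sym (++-identityʳ as)) (++⁺ˡ xs as⊆) ,
      trans (cong length (++-identityʳ as)) len , ras , []

module _ {N : ℕ} (χ : Colouring N) where

  LeftBlue : Fin N → Fin N → Set
  LeftBlue b c = ∀ a → a <ᶠ b → χ a b c ≡ blue

  leftBlue? : ∀ b c → Dec (LeftBlue b c)
  leftBlue? b c = all? (λ a → (a <ᶠ? b) →-dec (χ a b c ≟ blue))

  hasRedP4? : Dec (HasRedP4 χ)
  hasRedP4? = any? λ v₁ → any? λ v₂ → any? λ v₃ → any? λ v₄ →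
    (v₁ <ᶠ? v₂) ×-dec (v₂ <ᶠ? v₃) ×-dec (v₃ <ᶠ? v₄) ×-dec
    (χ v₁ v₂ v₃ ≟ red) ×-dec (χ v₂ v₃ v₄ ≟ red)

  module _ (noRedP4 : ¬ HasRedP4 χ) where

    red⇒leftBlue : ∀ {b c d} → b <ᶠ c → c <ᶠ d → χ b c d ≡ red → LeftBlue b c
    red⇒leftBlue {b} {c} {d} b<c c<d bcd a a<b with χ a b c in abc
    ... | true  = ⊥-elim (noRedP4 (a , b , c , d , a<b , b<c , c<d , abc , bcd))
    ... | false = refl

    blue-triple : ∀ {a b c} → a <ᶠ b → b <ᶠ c → ¬ LeftBlue a b ⊎ LeftBlue b c → χ a b c ≡ blue
    blue-triple {a} {b} {c} a<b b<c (inj₁ ¬ab) with χ a b c in abc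
    ... | true  = ⊥-elim (¬ab (red⇒leftBlue a<b b<c abc))
    ... | false = refl
    blue-triple a<b _ (inj₂ bc) = bc _ a<b

    blue-clique : ∀ {zs} → AllPairs _<ᶠ_ zs →
                  AllTriples (λ a b c → ¬ LeftBlue a b ⊎ LeftBlue b c) zs → HasBlueClique χ (length zs)
    blue-clique {zs} sorted good =
      lookup zs , AllPairs-lookup sorted , λ i j k i<j j<k →
        blue-triple (AllPairs-lookup sorted i j i<j) (AllPairs-lookup sorted j k j<k)
                    (AllTriples-lookup good i j k i<j j<k)

allFin-sorted : ∀ n → AllPairs _<ᶠ_ (allFin n)
allFin-sorted n = tabulate⁺-< id

length-take-allFin : ∀ m n → length (take m (allFin (m + n))) ≡ m
length-take-allFin m n = begin
  length (take m (allFin (m + n))) ≡⟨ length-take m (allFin (m + n)) ⟩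
  m ⊓ length (allFin (m + n))      ≡⟨ cong (m ⊓_) (length-tabulate id) ⟩
  m ⊓ (m + n)                      ≡⟨ m≤n⇒m⊓n≡m (m≤m+n m n) ⟩
  m                                ∎
  where open ≡-Reasoning

length-drop-allFin : ∀ m n → length (drop m (allFin (m + n))) ≡ n
length-drop-allFin m n = begin
  length (drop m (allFin (m + n))) ≡⟨ length-drop m (allFin (m + n)) ⟩
  length (allFin (m + n)) ∸ m      ≡⟨ cong (_∸ m) (length-tabulate id) ⟩
  m + n ∸ m                        ≡⟨ m+n∸m≡n m n ⟩
  n                                ∎
  where open ≡-Reasoning

arrows-+ : ∀ s t {H₁ H₂} → 2 ^ (s + suc (s + t)) ≤ H₁ → 2 ^ (suc (s + t) + t) ≤ H₂ →
           Arrows (H₁ + H₂) (2 + s + t)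
arrows-+ s t {H₁} {H₂} bound₁ bound₂ χ with hasRedP4? χ
... | yes redP4   = inj₁ redP4
... | no  noRedP4
  with split-chain (leftBlue? χ) s t (take H₁ (allFin (H₁ + H₂))) (drop H₁ (allFin (H₁ + H₂)))
         (subst (_ ≤_) (sym (length-take-allFin H₁ H₂)) bound₁)
         (subst (_ ≤_) (sym (length-drop-allFin H₁ H₂)) bound₂)
...   | as , bs , chain⊆ , len , nonLeftBlue , leftBlue =
  inj₂ (subst (HasBlueClique χ) len
    (blue-clique χ noRedP4
      (AllPairs-resp-⊆ (subst (as ++ bs ⊆_) (take++drop≡id H₁ _) chain⊆) (allFin-sorted _))
      (++-allTriples nonLeftBlue leftBlue)))

arrows-one : Arrows 1 1
arrows-one χ = inj₂ (id , (λ _ _ → id) , λ { fzero fzero _ () _ })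

powA≤2*powB : ∀ m → powA (suc m) ≤ 2 * powB (suc m)
powA≤2*powB m = subst (powA (suc m) ≤_) (eq (powA m) (powB m)) (m≤m+n _ (2 * powB m))
  where
  eq : ∀ a b → 2 * a + 2 * b + 2 * b ≡ 2 * (a + 2 * b)
  eq = solve-∀

powA-growth : ∀ m → 8 * powA (suc m) ≤ powA (3 + m)
powA-growth m = begin
  8 * a                     ≡⟨ split a ⟩
  6 * a + 2 * a             ≤⟨ +-monoʳ-≤ (6 * a) (*-monoʳ-≤ 2 (powA≤2*powB m)) ⟩
  6 * a + 2 * (2 * b)       ≤⟨ m≤m+n _ (4 * b) ⟩
  6 * a + 2 * (2 * b) + 4 * b ≡⟨ unfold a b ⟩
  powA (3 + m)              ∎
  where
  open ≤-Reasoning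
  a b : ℕ
  a = powA (suc m)
  b = powB (suc m)
  split : ∀ a → 8 * a ≡ 6 * a + 2 * a
  split = solve-∀
  unfold : ∀ a b → 6 * a + 2 * (2 * b) + 4 * b ≡ 2 * (2 * a + 2 * b) + 2 * (a + 2 * b)
  unfold = solve-∀

balanced-split : ∀ k → ∃[ s ] ∃[ t ]
  (s + t ≡ k × s ≤ t × 2 ^ (suc (s + t) + t) + 2 ^ (suc (s + t) + t) ≤ powA (2 + k))
balanced-split zero          = 0 , 0 , refl , z≤n , m≤m+n 4 2
balanced-split (suc zero)    = 0 , 1 , refl , z≤n , m≤m+n 16 4
balanced-split (suc (suc k)) with balanced-split k
... | s , t , refl , s≤t , bound =
  suc s , suc t , cong suc (+-suc s t) , s≤s s≤t ,
  subst (λ e → 2 ^ e + 2 ^ e ≤ powA (4 + (s + t))) (sym (exponent s t))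
    (subst (_≤ powA (4 + (s + t))) (eight-halves (2 ^ (suc (s + t) + t)))
      (≤-trans (*-monoʳ-≤ 8 bound) (powA-growth (suc k))))
  where
  exponent : ∀ s t → suc (suc s + suc t) + suc t ≡ 3 + (suc (s + t) + t)
  exponent = solve-∀
  eight-halves : ∀ y → 8 * (y + y) ≡ 2 * (2 * (2 * y)) + 2 * (2 * (2 * y))
  eight-halves = solve-∀

corollary4 : ∀ (n : ℕ) → n > 0 → ∀ (c : ℕ) → IsCeilPow n c →
    ∃[ N ] (N ≤ c × Arrows N n)
corollary4 (suc zero) _ c ((powA≤c , _) , _) = 1 , ≤-trans (s≤s z≤n) powA≤c , arrows-one
corollary4 (suc (suc k)) _ c ((powA≤c , _) , _) with balanced-split k
... | s , t , refl , s≤t , bound =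
  2 ^ e + 2 ^ e , ≤-trans bound powA≤c , arrows-+ s t (^-monoʳ-≤ 2 left≤right) ≤-refl
  where
  e : ℕ
  e = suc (s + t) + t
  left≤right : s + suc (s + t) ≤ e
  left≤right = ≤-trans (≤-reflexive (+-comm s _)) (+-monoʳ-≤ (suc (s + t)) s≤t)
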